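{- Let $n,r,t$ be positive integers with $r,t\ge2$ and $n\ge tr$. Let $G$ be an $r$-graph on $[n]$ not containing $M^r_t$ that is left-compressed relative to the natural order. Then the link $L_G(n)$ does not contain $M^{r-1}_t$. Furthermore, if $r=3$ and $\{n-1,n\}$ is contained in some edge of $G$, then $G[\{2,\dots,n\}]$ does not contain $M^3_{t-1}$.
   Context: An $r$-graph is a vertex set with a family of $r$-element subsets (edges). $M^s_t$ is the $s$-graph consisting of $t$ pairwise disjoint edges. The link of vertex $v$ is the $(r-1)$-graph $L_G(v)=\{e\subseteq V(G)\setminus\{v\}:e\cup\{v\}\in E(G)\}$; $G[S]$ is the subgraph induced on $S$. For distinct $i,j$, $L_G(j\setminus i)=\{f\subseteq[n]\setminus\{i,j\}:|f|=r-1, f\cup\{j\}\in E(G), f\cup\{i\}\notin E(G)\}$ and $\pi_{ij}(G)$ has edge set $(E(G)\setminus\{f\cup\{j\}:f\in L_G(j\setminus i)\})\cup\{f\cup\{i\}:f\in L_G(j\setminus i)\}$. $G$ is left-compressed relative to the natural order if $\pi_{ij}(G)=G$ for all $i<j$. -}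

module Defs where

open import Data.Nat using (ℕ; suc; _∸_)
open import Data.Bool using (Bool; true; false; _∧_; not; if_then_else_)
open import Data.Fin using (Fin; toℕ; _<_)
open import Data.Fin.Subset using (Subset; _∈_; _∉_; _⊆_; _∪_; _-_; ⁅_⁆; ∣_∣)
open import Data.Fin.Subset.Properties using (_∈?_)
open import Data.Vec using (Vec; lookup)
open import Data.Product using (Σ; _×_)
open import Relation.Nullary.Decidable using (⌊_⌋)
open import Relation.Binary.PropositionalEquality using (_≡_; _≢_)

-- Convention: the vertex set [n] = {1,…,n} is represented by Fin n,
-- the element i : Fin n standing for the vertex (toℕ i + 1).
-- The natural order on [n] is thus the order of Fin n.

label : {n : ℕ} → Fin n → ℕ
label i = suc (toℕ i)

Family : ℕ → Set
Family n = Subset n → Bool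

record RGraph (r n : ℕ) : Set where
  field
    E       : Family n
    uniform : ∀ e → E e ≡ true → ∣ e ∣ ≡ r
open RGraph public

Disjoint : {n : ℕ} → Subset n → Subset n → Set
Disjoint p q = ∀ x → x ∈ p → x ∈ q → Data.Empty.⊥
  where import Data.Empty

ContainsMatching : {n : ℕ} → Family n → (s t : ℕ) → Set
ContainsMatching {n} H s t =
  Σ (Vec (Subset n) t) λ es →
    (∀ a → H (lookup es a) ≡ true × ∣ lookup es a ∣ ≡ s) ×
    (∀ a b → a ≢ b → Disjoint (lookup es a) (lookup es b))

_∈ᵇ_ : {n : ℕ} → Fin n → Subset n → Bool
x ∈ᵇ p = ⌊ x ∈? p ⌋

Link : {n : ℕ} → Family n → Fin n → Family n
Link E v f = not (v ∈ᵇ f) ∧ E (f ∪ ⁅ v ⁆)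

-- Writing e = f ∪ {j} with f avoiding i, j:
-- f ∈ L(j∖i) iff j ∈ e, i ∉ e, e ∈ E and (e - j) ∪ {i} ∉ E.
-- π_ij(E) = (E minus {f ∪ {j} : f ∈ L(j∖i)}) ∪ {f ∪ {i} : f ∈ L(j∖i)}.
-- (The size condition |f| = r-1 is automatic for r-graphs since f ∪ {j} ∈ E.)
InLji : {n : ℕ} → Family n → Fin n → Fin n → Subset n → Bool
InLji E i j f = not (i ∈ᵇ f) ∧ not (j ∈ᵇ f) ∧ E (f ∪ ⁅ j ⁆) ∧ not (E (f ∪ ⁅ i ⁆))

shift : {n : ℕ} → Fin n → Fin n → Family n → Family n
shift i j E e =
  if E e
  then not (j ∈ᵇ e ∧ InLji E i j (e - j))   -- removed iff e = f ∪ {j}, f ∈ L(j∖i)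
  else (i ∈ᵇ e ∧ InLji E i j (e - i))       -- added iff e = f ∪ {i}, f ∈ L(j∖i)

LeftCompressed : {n : ℕ} → Family n → Set
LeftCompressed {n} E = ∀ (i j : Fin n) → i < j → ∀ e → shift i j E e ≡ E e

Induced : {n : ℕ} → Family n → Subset n → Family n
Induced E S e = E e ∧ ⌊ Data.Fin.Subset.Properties._⊆?_ e S ⌋

fromTwo : (n : ℕ) → Subset n
fromTwo n = Data.Vec.tabulate λ (i : Fin n) → ⌊ 1 Data.Nat.≤? toℕ i ⌋
  where import Data.Nat

module Submission where

-- If the link of n contained t disjoint (r−1)-sets f₁,…,f_t, their union would have at most
-- t(r−1) ≤ n − t vertices, leaving distinct vertices w₁,…,w_t outside it; left-compression
-- moves n to w_a in the edge f_a ∪ {n}, so the f_a ∪ {w_a} would be t disjoint edges of G.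
-- For r = 3, shifting the third vertex of an edge {a, n−1, n} down to 1 gives {1, n−1, n}.
-- Given t−1 disjoint edges inside {2,…,n}, pick x < y outside their union and different
-- from 1; the shifts n−1 ↦ x and then n ↦ y produce the edge {1, x, y}, a t-th disjoint one.

open import Defs
open import Data.Nat using (ℕ; zero; suc; _≤_; _*_; _∸_; _+_; z≤n; s≤s; s≤s⁻¹)
open import Data.Nat.Properties
  using (≤-trans; ≤-reflexive; <-≤-trans; n≮n; +-monoʳ-≤; +-mono-≤; +-suc; *-suc; suc-injective)
open import Data.Bool using (true; false)
open import Data.Bool.Properties using (not-involutive; not-injective; ∧-conicalˡ; ∧-conicalʳ)
open import Data.Fin using (Fin; zero; suc; toℕ; fromℕ; pred) renaming (_<_ to _<ᶠ_; _≤_ to _≤ᶠ_)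
open import Data.Fin.Properties
  using (toℕ<n; toℕ-fromℕ; toℕ-inject₁; <-cmp; <⇒≢; ≤∧≢⇒<; <⇒≤pred; fromℕ≢inject₁)
  renaming (_≟_ to _≟ᶠ_)
open import Data.Fin.Subset using (Subset; _∈_; _∉_; _⊆_; _∪_; _-_; ⁅_⁆; ∣_∣; ⊥; inside; outside)
open import Data.Fin.Subset.Properties
  using (_∈?_; _⊆?_; x∈p∪q⁺; x∈p∪q⁻; x∈⁅x⁆; x∈⁅y⁆⇒x≡y; ∣⁅x⁆∣≡1; ∣⊥∣≡0; ∣p∣≤∣x∷p∣;
         p⊆q⇒∣p∣≤∣q∣; ∉⊥; drop-∷-⊆; drop-there; drop-not-there; ∪-identityʳ; ∪-comm; ∪-assoc; p─⊥≡p)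
open import Data.Vec using (Vec; []; _∷_; lookup; tabulate; here)
open import Data.Vec.Properties using (lookup∘tabulate)
open import Data.Product using (Σ; _×_; _,_; proj₁; proj₂)
open import Data.Sum using (_⊎_; inj₁; inj₂; [_,_]; map₂)
open import Function using (_∘_)
open import Relation.Binary.Core using (_Preserves_⟶_)
open import Relation.Binary.Definitions using (tri<; tri≈; tri>)
open import Relation.Nullary using (¬_; Dec; yes; no; contradiction)
open import Relation.Nullary.Decidable using (⌊_⌋; isYes≗does; dec-true; dec-false)
open import Relation.Binary.PropositionalEquality
  using (_≡_; _≢_; refl; sym; trans; cong; subst; ≢-sym)

isYes-true⇒ : ∀ {A : Set} (a? : Dec A) → ⌊ a? ⌋ ≡ true → A
isYes-true⇒ (yes a) _ = a

isYes-false⇒ : ∀ {A : Set} (a? : Dec A) → ⌊ a? ⌋ ≡ false → ¬ A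
isYes-false⇒ (no ¬a) _ = ¬a

∈ᵇ-true : ∀ {n} {x : Fin n} {p} → x ∈ p → x ∈ᵇ p ≡ true
∈ᵇ-true {x = x} {p} x∈p = trans (isYes≗does (x ∈? p)) (dec-true (x ∈? p) x∈p)

∈ᵇ-false : ∀ {n} {x : Fin n} {p} → x ∉ p → x ∈ᵇ p ≡ false
∈ᵇ-false {x = x} {p} x∉p = trans (isYes≗does (x ∈? p)) (dec-false (x ∈? p) x∉p)

∣p∪q∣≤∣p∣+∣q∣ : ∀ {n} (p q : Subset n) → ∣ p ∪ q ∣ ≤ ∣ p ∣ + ∣ q ∣
∣p∪q∣≤∣p∣+∣q∣ [] [] = z≤n
∣p∪q∣≤∣p∣+∣q∣ (inside ∷ p) (b ∷ q) =
  s≤s (≤-trans (∣p∪q∣≤∣p∣+∣q∣ p q) (+-monoʳ-≤ ∣ p ∣ (∣p∣≤∣x∷p∣ b q)))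
∣p∪q∣≤∣p∣+∣q∣ (outside ∷ p) (inside ∷ q) rewrite +-suc ∣ p ∣ ∣ q ∣ = s≤s (∣p∪q∣≤∣p∣+∣q∣ p q)
∣p∪q∣≤∣p∣+∣q∣ (outside ∷ p) (outside ∷ q) = ∣p∪q∣≤∣p∣+∣q∣ p q

x∉p⇒∣p∪⁅x⁆∣≡1+∣p∣ : ∀ {n} (p : Subset n) {x} → x ∉ p → ∣ p ∪ ⁅ x ⁆ ∣ ≡ suc ∣ p ∣
x∉p⇒∣p∪⁅x⁆∣≡1+∣p∣ (outside ∷ p) {zero}  _   = cong (suc ∘ ∣_∣) (∪-identityʳ p)
x∉p⇒∣p∪⁅x⁆∣≡1+∣p∣ (inside  ∷ p) {zero}  x∉p = contradiction here x∉p
x∉p⇒∣p∪⁅x⁆∣≡1+∣p∣ (outside ∷ p) {suc x} x∉p = x∉p⇒∣p∪⁅x⁆∣≡1+∣p∣ p (drop-not-there x∉p)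
x∉p⇒∣p∪⁅x⁆∣≡1+∣p∣ (inside  ∷ p) {suc x} x∉p = cong suc (x∉p⇒∣p∪⁅x⁆∣≡1+∣p∣ p (drop-not-there x∉p))

p⊆q∧∣q∣≤∣p∣⇒p≡q : ∀ {n} {p q : Subset n} → p ⊆ q → ∣ q ∣ ≤ ∣ p ∣ → p ≡ q
p⊆q∧∣q∣≤∣p∣⇒p≡q {p = []}          {[]}          _   _ = refl
p⊆q∧∣q∣≤∣p∣⇒p≡q {p = outside ∷ p} {outside ∷ q} p⊆q h =
  cong (outside ∷_) (p⊆q∧∣q∣≤∣p∣⇒p≡q (drop-∷-⊆ p⊆q) h)
p⊆q∧∣q∣≤∣p∣⇒p≡q {p = inside  ∷ p} {inside  ∷ q} p⊆q h =
  cong (inside ∷_) (p⊆q∧∣q∣≤∣p∣⇒p≡q (drop-∷-⊆ p⊆q) (s≤s⁻¹ h))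
p⊆q∧∣q∣≤∣p∣⇒p≡q {p = inside  ∷ p} {outside ∷ q} p⊆q _ = contradiction (p⊆q here) λ ()
p⊆q∧∣q∣≤∣p∣⇒p≡q {p = outside ∷ p} {inside  ∷ q} p⊆q h =
  contradiction (≤-trans h (p⊆q⇒∣p∣≤∣q∣ (drop-∷-⊆ p⊆q))) (n≮n ∣ q ∣)

p⊆q∧∣q∣≡1+∣p∣⇒q≡p∪⁅x⁆ : ∀ {n} {p q : Subset n} → p ⊆ q → ∣ q ∣ ≡ suc ∣ p ∣ →
  Σ (Fin n) λ x → x ∉ p × q ≡ p ∪ ⁅ x ⁆
p⊆q∧∣q∣≡1+∣p∣⇒q≡p∪⁅x⁆ {p = []} {[]} _ ()
p⊆q∧∣q∣≡1+∣p∣⇒q≡p∪⁅x⁆ {p = outside ∷ p} {outside ∷ q} p⊆q h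
  with x , x∉p , q≡p∪x ← p⊆q∧∣q∣≡1+∣p∣⇒q≡p∪⁅x⁆ (drop-∷-⊆ p⊆q) h
  = suc x , x∉p ∘ drop-there , cong (outside ∷_) q≡p∪x
p⊆q∧∣q∣≡1+∣p∣⇒q≡p∪⁅x⁆ {p = inside ∷ p} {inside ∷ q} p⊆q h
  with x , x∉p , q≡p∪x ← p⊆q∧∣q∣≡1+∣p∣⇒q≡p∪⁅x⁆ (drop-∷-⊆ p⊆q) (suc-injective h)
  = suc x , x∉p ∘ drop-there , cong (inside ∷_) q≡p∪x
p⊆q∧∣q∣≡1+∣p∣⇒q≡p∪⁅x⁆ {p = inside ∷ p} {outside ∷ q} p⊆q _ = contradiction (p⊆q here) λ ()
p⊆q∧∣q∣≡1+∣p∣⇒q≡p∪⁅x⁆ {p = outside ∷ p} {inside ∷ q} p⊆q h =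
  zero , (λ ()) , cong (inside ∷_) (trans (sym p≡q) (sym (∪-identityʳ p)))
  where
  p≡q : p ≡ q
  p≡q = p⊆q∧∣q∣≤∣p∣⇒p≡q (drop-∷-⊆ p⊆q) (≤-reflexive (suc-injective h))

x∉p⇒p∪⁅x⁆-x≡p : ∀ {n} (p : Subset n) {x} → x ∉ p → (p ∪ ⁅ x ⁆) - x ≡ p
x∉p⇒p∪⁅x⁆-x≡p (outside ∷ p) {zero}  _   = cong (outside ∷_) (trans (p─⊥≡p (p ∪ ⊥)) (∪-identityʳ p))
x∉p⇒p∪⁅x⁆-x≡p (inside  ∷ p) {zero}  x∉p = contradiction here x∉p
x∉p⇒p∪⁅x⁆-x≡p (outside ∷ p) {suc x} x∉p = cong (outside ∷_) (x∉p⇒p∪⁅x⁆-x≡p p (drop-not-there x∉p))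
x∉p⇒p∪⁅x⁆-x≡p (inside  ∷ p) {suc x} x∉p = cong (inside ∷_) (x∉p⇒p∪⁅x⁆-x≡p p (drop-not-there x∉p))

∈⁅x⁆∪⁅y⁆⁻ : ∀ {n} {z : Fin n} x y → z ∈ ⁅ x ⁆ ∪ ⁅ y ⁆ → z ≡ x ⊎ z ≡ y
∈⁅x⁆∪⁅y⁆⁻ x y z∈ with x∈p∪q⁻ ⁅ x ⁆ ⁅ y ⁆ z∈
... | inj₁ z∈x = inj₁ (x∈⁅y⁆⇒x≡y x z∈x)
... | inj₂ z∈y = inj₂ (x∈⁅y⁆⇒x≡y y z∈y)

∉⁅x⁆∪⁅y⁆ : ∀ {n} {z : Fin n} x y → z ≢ x → z ≢ y → z ∉ ⁅ x ⁆ ∪ ⁅ y ⁆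
∉⁅x⁆∪⁅y⁆ x y z≢x z≢y z∈ = [ z≢x , z≢y ] (∈⁅x⁆∪⁅y⁆⁻ x y z∈)

∣⁅x⁆∪⁅y⁆∣≡2 : ∀ {n} {x y : Fin n} → x ≢ y → ∣ ⁅ x ⁆ ∪ ⁅ y ⁆ ∣ ≡ 2
∣⁅x⁆∪⁅y⁆∣≡2 {x = x} x≢y =
  trans (x∉p⇒∣p∪⁅x⁆∣≡1+∣p∣ ⁅ x ⁆ (x≢y ∘ sym ∘ x∈⁅y⁆⇒x≡y x)) (cong suc (∣⁅x⁆∣≡1 x))

triple : ∀ {n} → Fin n → Fin n → Fin n → Subset n
triple x y z = (⁅ x ⁆ ∪ ⁅ y ⁆) ∪ ⁅ z ⁆

∈triple⁻ : ∀ {n} {v : Fin n} x y z → v ∈ triple x y z → v ≡ x ⊎ v ≡ y ⊎ v ≡ z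
∈triple⁻ x y z v∈ with x∈p∪q⁻ (⁅ x ⁆ ∪ ⁅ y ⁆) ⁅ z ⁆ v∈
... | inj₁ v∈xy = map₂ inj₁ (∈⁅x⁆∪⁅y⁆⁻ x y v∈xy)
... | inj₂ v∈z  = inj₂ (inj₂ (x∈⁅y⁆⇒x≡y z v∈z))

triple-rotate : ∀ {n} (x y z : Fin n) → triple x y z ≡ triple z x y
triple-rotate x y z = trans (∪-comm (⁅ x ⁆ ∪ ⁅ y ⁆) ⁅ z ⁆) (sym (∪-assoc ⁅ z ⁆ ⁅ x ⁆ ⁅ y ⁆))

x∈p∧y∈p∧∣p∣≡3⇒p≡triple : ∀ {n} {p : Subset n} {x y} → ∣ p ∣ ≡ 3 → x ≢ y → x ∈ p → y ∈ p →
  Σ (Fin n) λ z → z ∉ ⁅ x ⁆ ∪ ⁅ y ⁆ × p ≡ triple x y z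
x∈p∧y∈p∧∣p∣≡3⇒p≡triple {p = p} {x} {y} ∣p∣≡3 x≢y x∈p y∈p =
  p⊆q∧∣q∣≡1+∣p∣⇒q≡p∪⁅x⁆ xy⊆p (trans ∣p∣≡3 (cong suc (sym (∣⁅x⁆∪⁅y⁆∣≡2 x≢y))))
  where
  xy⊆p : ⁅ x ⁆ ∪ ⁅ y ⁆ ⊆ p
  xy⊆p z∈ with ∈⁅x⁆∪⁅y⁆⁻ x y z∈
  ... | inj₁ refl = x∈p
  ... | inj₂ refl = y∈p

⋃ᵥ : ∀ {n t} → Vec (Subset n) t → Subset n
⋃ᵥ []       = ⊥
⋃ᵥ (p ∷ ps) = p ∪ ⋃ᵥ ps

lookup⊆⋃ᵥ : ∀ {n t} (ps : Vec (Subset n) t) a → lookup ps a ⊆ ⋃ᵥ ps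
lookup⊆⋃ᵥ (p ∷ ps) zero    x∈ = x∈p∪q⁺ (inj₁ x∈)
lookup⊆⋃ᵥ (p ∷ ps) (suc a) x∈ = x∈p∪q⁺ (inj₂ (lookup⊆⋃ᵥ ps a x∈))

⋃ᵥ⊆ : ∀ {n t} {S : Subset n} (ps : Vec (Subset n) t) → (∀ a → lookup ps a ⊆ S) → ⋃ᵥ ps ⊆ S
⋃ᵥ⊆ []       _    x∈ = contradiction x∈ ∉⊥
⋃ᵥ⊆ (p ∷ ps) ps⊆S x∈ = [ ps⊆S zero , ⋃ᵥ⊆ ps (ps⊆S ∘ suc) ] (x∈p∪q⁻ p (⋃ᵥ ps) x∈)

∣⋃ᵥ∣≤t*s : ∀ {n t s} (ps : Vec (Subset n) t) → (∀ a → ∣ lookup ps a ∣ ≡ s) → ∣ ⋃ᵥ ps ∣ ≤ t * s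
∣⋃ᵥ∣≤t*s {n} [] _ = ≤-reflexive (∣⊥∣≡0 n)
∣⋃ᵥ∣≤t*s (p ∷ ps) ∣ps∣≡s = ≤-trans (∣p∪q∣≤∣p∣+∣q∣ p (⋃ᵥ ps))
  (+-mono-≤ (≤-reflexive (∣ps∣≡s zero)) (∣⋃ᵥ∣≤t*s ps (∣ps∣≡s ∘ suc)))

pickOutside : ∀ {n} k (q : Subset n) → k + ∣ q ∣ ≤ n →
  Σ (Fin k → Fin n) λ v → v Preserves _<ᶠ_ ⟶ _<ᶠ_ × (∀ a → v a ∉ q)
pickOutside zero    q  _ = (λ ()) , (λ {}) , λ ()
pickOutside (suc k) [] ()
pickOutside {suc n} (suc k) (inside ∷ q) h
  with v , v-mono , v∉q ← pickOutside (suc k) q (subst (_≤ n) (+-suc k ∣ q ∣) (s≤s⁻¹ h))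
  = suc ∘ v , s≤s ∘ v-mono , λ a → v∉q a ∘ drop-there
pickOutside (suc k) (outside ∷ q) (s≤s h)
  with v , v-mono , v∉q ← pickOutside k q h
  = w , w-mono , w∉q
  where
  w : Fin (suc k) → Fin _
  w zero    = zero
  w (suc a) = suc (v a)
  w-mono : w Preserves _<ᶠ_ ⟶ _<ᶠ_
  w-mono {zero}  {suc b} _       = s≤s z≤n
  w-mono {suc a} {suc b} (s≤s a<b) = s≤s (v-mono a<b)
  w∉q : ∀ a → w a ∉ outside ∷ q
  w∉q zero    ()
  w∉q (suc a) = v∉q a ∘ drop-there

strictMono⇒≢ : ∀ {k n} {v : Fin k → Fin n} → v Preserves _<ᶠ_ ⟶ _<ᶠ_ → ∀ {a b} → a ≢ b → v a ≢ v b
strictMono⇒≢ v-mono {a} {b} a≢b with <-cmp a b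
... | tri< a<b _   _   = <⇒≢ (v-mono a<b)
... | tri≈ _   a≡b _   = contradiction a≡b a≢b
... | tri> _   _   b<a = ≢-sym (<⇒≢ (v-mono b<a))

≤-last : ∀ {n} {v : Fin n} → label v ≡ n → ∀ w → w ≤ᶠ v
≤-last lv w = s≤s⁻¹ (subst (suc (toℕ w) ≤_) (sym lv) (toℕ<n w))

shift-∪⁅j⁆ : ∀ {n} (H : Family n) {i j : Fin n} {f} → i ∉ f → j ∉ f → H (f ∪ ⁅ j ⁆) ≡ true →
  shift i j H (f ∪ ⁅ j ⁆) ≡ H (f ∪ ⁅ i ⁆)
shift-∪⁅j⁆ H {i} {j} {f} i∉f j∉f Hfj
  rewrite Hfj | x∉p⇒p∪⁅x⁆-x≡p f j∉f | ∈ᵇ-true {x = j} {f ∪ ⁅ j ⁆} (x∈p∪q⁺ (inj₂ (x∈⁅x⁆ j)))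
        | ∈ᵇ-false i∉f | ∈ᵇ-false j∉f | Hfj
  = not-involutive (H (f ∪ ⁅ i ⁆))

compressed-shift : ∀ {n} {H : Family n} → LeftCompressed H → ∀ f {i j : Fin n} →
  i ≤ᶠ j → i ∉ f → j ∉ f → H (f ∪ ⁅ j ⁆) ≡ true → H (f ∪ ⁅ i ⁆) ≡ true
compressed-shift {H = H} lc f {i} {j} i≤j i∉f j∉f Hfj with i ≟ᶠ j
... | yes refl = Hfj
... | no i≢j   = trans (sym (shift-∪⁅j⁆ H i∉f j∉f Hfj)) (trans (lc i j (≤∧≢⇒< i≤j i≢j) _) Hfj)

zero∉fromTwo : ∀ k → zero ∉ fromTwo (suc k)
zero∉fromTwo k ()

PairwiseDisjoint : ∀ {n t} → (Fin t → Subset n) → Set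
PairwiseDisjoint g = ∀ a b → a ≢ b → Disjoint (g a) (g b)

disjointEdges⇒matching : ∀ {r n t} (G : RGraph r n) (g : Fin t → Subset n) →
  (∀ a → E G (g a) ≡ true) → PairwiseDisjoint g → ContainsMatching (E G) r t
disjointEdges⇒matching G g edge disj = tabulate g , edge′ , disj′
  where
  edge′ : ∀ a → E G (lookup (tabulate g) a) ≡ true × ∣ lookup (tabulate g) a ∣ ≡ _
  edge′ a rewrite lookup∘tabulate g a = edge a , uniform G (g a) (edge a)
  disj′ : PairwiseDisjoint (lookup (tabulate g))
  disj′ a b rewrite lookup∘tabulate g a | lookup∘tabulate g b = disj a b

∪⁅⁆-pairwiseDisjoint : ∀ {n t} (fs : Vec (Subset n) t) {w : Fin t → Fin n} →
  PairwiseDisjoint (lookup fs) → (∀ {a b} → a ≢ b → w a ≢ w b) → (∀ a → w a ∉ ⋃ᵥ fs) →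
  PairwiseDisjoint (λ a → lookup fs a ∪ ⁅ w a ⁆)
∪⁅⁆-pairwiseDisjoint fs {w} disj w-inj w∉⋃ a b a≢b x x∈a x∈b
  with x∈p∪q⁻ (lookup fs a) _ x∈a | x∈p∪q⁻ (lookup fs b) _ x∈b
... | inj₁ x∈fa | inj₁ x∈fb = disj a b a≢b x x∈fa x∈fb
... | inj₁ x∈fa | inj₂ x∈wb = w∉⋃ b (lookup⊆⋃ᵥ fs a (subst (_∈ _) (x∈⁅y⁆⇒x≡y (w b) x∈wb) x∈fa))
... | inj₂ x∈wa | inj₁ x∈fb = w∉⋃ a (lookup⊆⋃ᵥ fs b (subst (_∈ _) (x∈⁅y⁆⇒x≡y (w a) x∈wa) x∈fb))
... | inj₂ x∈wa | inj₂ x∈wb =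
  w-inj a≢b (trans (sym (x∈⁅y⁆⇒x≡y (w a) x∈wa)) (x∈⁅y⁆⇒x≡y (w b) x∈wb))

∷-pairwiseDisjoint : ∀ {n t} {e : Subset n} (es : Vec (Subset n) t) →
  PairwiseDisjoint (lookup es) → Disjoint e (⋃ᵥ es) → PairwiseDisjoint (lookup (e ∷ es))
∷-pairwiseDisjoint es disj e∩⋃ zero    zero    a≢b = contradiction refl a≢b
∷-pairwiseDisjoint es disj e∩⋃ zero    (suc b) _ x x∈e x∈b = e∩⋃ x x∈e (lookup⊆⋃ᵥ es b x∈b)
∷-pairwiseDisjoint es disj e∩⋃ (suc a) zero    _ x x∈a x∈e = e∩⋃ x x∈e (lookup⊆⋃ᵥ es a x∈a)
∷-pairwiseDisjoint es disj e∩⋃ (suc a) (suc b) a≢b = disj a b (a≢b ∘ cong suc)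

linkOfLast-¬matching : ∀ {n r t} (G : RGraph (suc r) n) → LeftCompressed (E G) → t * suc r ≤ n →
  ¬ ContainsMatching (E G) (suc r) t → ∀ v → label v ≡ n → ¬ ContainsMatching (Link (E G) v) r t
linkOfLast-¬matching {n} {r} {t} G lc tr≤n ¬M v lv (fs , link , disj) =
  ¬M (disjointEdges⇒matching G (λ a → lookup fs a ∪ ⁅ w a ⁆) edge
         (∪⁅⁆-pairwiseDisjoint fs disj (strictMono⇒≢ (proj₁ (proj₂ picked))) w∉⋃))
  where
  room : t + ∣ ⋃ᵥ fs ∣ ≤ n
  room = ≤-trans (+-monoʳ-≤ t (∣⋃ᵥ∣≤t*s fs (proj₂ ∘ link))) (subst (_≤ n) (*-suc t r) tr≤n)
  picked : Σ (Fin t → Fin n) λ w → w Preserves _<ᶠ_ ⟶ _<ᶠ_ × (∀ a → w a ∉ ⋃ᵥ fs)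
  picked = pickOutside t (⋃ᵥ fs) room
  w : Fin t → Fin n
  w = proj₁ picked
  w∉⋃ : ∀ a → w a ∉ ⋃ᵥ fs
  w∉⋃ = proj₂ (proj₂ picked)
  v∉fs : ∀ a → v ∉ lookup fs a
  v∉fs a = isYes-false⇒ (v ∈? lookup fs a) (not-injective (∧-conicalˡ _ _ (proj₁ (link a))))
  edge : ∀ a → E G (lookup fs a ∪ ⁅ w a ⁆) ≡ true
  edge a = compressed-shift lc (lookup fs a) (≤-last lv (w a)) (w∉⋃ a ∘ lookup⊆⋃ᵥ fs a) (v∉fs a)
    (∧-conicalʳ _ _ (proj₁ (link a)))

inducedFromTwo-¬matching : ∀ {n s} (G : RGraph 3 n) → LeftCompressed (E G) → suc s * 3 ≤ n →
  ¬ ContainsMatching (E G) 3 (suc s) →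
  Σ (Subset n) (λ e → E G e ≡ true × ((v : Fin n) → label v ≡ n ∸ 1 ⊎ label v ≡ n → v ∈ e)) →
  ¬ ContainsMatching (Induced (E G) (fromTwo n)) 3 s
inducedFromTwo-¬matching {suc (suc (suc m))} G lc 3t≤n@(s≤s (s≤s (s≤s _))) ¬M
  (e , e∈G , lastTwo⊆e) (es , induced , disj) =
  ¬M (disjointEdges⇒matching G (lookup (triple zero x y ∷ es)) edge
        (∷-pairwiseDisjoint es disj fresh))
  where
  IsEdge : Subset (3 + m) → Set
  IsEdge S = E G S ≡ true
  q p : Fin (3 + m)
  q = fromℕ (suc (suc m))
  p = pred q
  lq : label q ≡ 3 + m
  lq = cong suc (toℕ-fromℕ _)
  lp : label p ≡ 2 + m
  lp = cong (2 +_) (trans (toℕ-inject₁ (fromℕ m)) (toℕ-fromℕ m))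
  p≢q : p ≢ q
  p≢q = ≢-sym fromℕ≢inject₁
  e≡pq∪a : Σ (Fin (3 + m)) λ a → a ∉ ⁅ p ⁆ ∪ ⁅ q ⁆ × e ≡ triple p q a
  e≡pq∪a = x∈p∧y∈p∧∣p∣≡3⇒p≡triple (uniform G e e∈G) p≢q
            (lastTwo⊆e p (inj₁ lp)) (lastTwo⊆e q (inj₂ lq))
  W₀ : Subset (3 + m)
  W₀ = ⁅ zero ⁆ ∪ ⋃ᵥ es
  room : 2 + ∣ W₀ ∣ ≤ 3 + m
  room = ≤-trans (+-monoʳ-≤ 2 (≤-trans (∣p∪q∣≤∣p∣+∣q∣ ⁅ zero ⁆ (⋃ᵥ es))
    (+-mono-≤ (≤-reflexive (∣⁅x⁆∣≡1 {n = 3 + m} zero)) (∣⋃ᵥ∣≤t*s es (proj₂ ∘ induced))))) 3t≤n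
  picked : Σ (Fin 2 → Fin (3 + m)) λ w → w Preserves _<ᶠ_ ⟶ _<ᶠ_ × (∀ c → w c ∉ W₀)
  picked = pickOutside 2 W₀ room
  x y : Fin (3 + m)
  x = proj₁ picked zero
  y = proj₁ picked (suc zero)
  x<y : x <ᶠ y
  x<y = proj₁ (proj₂ picked) (s≤s z≤n)
  x<q : x <ᶠ q
  x<q = <-≤-trans x<y (≤-last lq y)
  ≢zero : ∀ c → proj₁ picked c ≢ zero
  ≢zero c wc≡0 =
    proj₂ (proj₂ picked) c (x∈p∪q⁺ (inj₁ (subst (_∈ ⁅ zero ⁆) (sym wc≡0) (x∈⁅x⁆ zero))))
  ∉⋃ : ∀ c → proj₁ picked c ∉ ⋃ᵥ es
  ∉⋃ c = proj₂ (proj₂ picked) c ∘ x∈p∪q⁺ ∘ inj₂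
  e₀ : IsEdge (triple p q zero)
  e₀ = compressed-shift lc (⁅ p ⁆ ∪ ⁅ q ⁆) z≤n (∉⁅x⁆∪⁅y⁆ p q (λ ()) (λ ())) (proj₁ (proj₂ e≡pq∪a))
         (subst IsEdge (proj₂ (proj₂ e≡pq∪a)) e∈G)
  e₁ : IsEdge (triple q zero x)
  e₁ = compressed-shift lc (⁅ q ⁆ ∪ ⁅ zero ⁆) (<⇒≤pred x<q)
         (∉⁅x⁆∪⁅y⁆ q zero (<⇒≢ x<q) (≢zero zero)) (∉⁅x⁆∪⁅y⁆ q zero p≢q (λ ()))
         (subst IsEdge (sym (triple-rotate q zero p)) e₀)
  e₂ : IsEdge (triple zero x y)
  e₂ = compressed-shift lc (⁅ zero ⁆ ∪ ⁅ x ⁆) (≤-last lq y)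
         (∉⁅x⁆∪⁅y⁆ zero x (≢zero (suc zero)) (≢-sym (<⇒≢ x<y)))
         (∉⁅x⁆∪⁅y⁆ zero x (λ ()) (≢-sym (<⇒≢ x<q)))
         (subst IsEdge (sym (triple-rotate zero x q)) e₁)
  edge : ∀ b → IsEdge (lookup (triple zero x y ∷ es) b)
  edge zero    = e₂
  edge (suc b) = ∧-conicalˡ _ _ (proj₁ (induced b))
  ⋃⊆fromTwo : ⋃ᵥ es ⊆ fromTwo (3 + m)
  ⋃⊆fromTwo = ⋃ᵥ⊆ es λ b → isYes-true⇒ (lookup es b ⊆? _) (∧-conicalʳ _ _ (proj₁ (induced b)))
  fresh : Disjoint (triple zero x y) (⋃ᵥ es)
  fresh z z∈ z∈⋃ with ∈triple⁻ zero x y z∈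
  ... | inj₁ refl        = contradiction (⋃⊆fromTwo z∈⋃) (zero∉fromTwo (2 + m))
  ... | inj₂ (inj₁ refl) = ∉⋃ zero z∈⋃
  ... | inj₂ (inj₂ refl) = ∉⋃ (suc zero) z∈⋃

lemma4p14 : (n r t : ℕ) → 2 ≤ r → 2 ≤ t → t * r ≤ n →
    (G : RGraph r n) →
    ¬ ContainsMatching (E G) r t →
    LeftCompressed (E G) →
    ((v : Fin n) → label v ≡ n → ¬ ContainsMatching (Link (E G) v) (r ∸ 1) t)
    ×
    (r ≡ 3 →
     Σ (Subset n) (λ e → E G e ≡ true × ((v : Fin n) → label v ≡ n ∸ 1 ⊎ label v ≡ n → v ∈ e)) →
     ¬ ContainsMatching (Induced (E G) (fromTwo n)) 3 (t ∸ 1))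
lemma4p14 n (suc r) (suc s) (s≤s _) (s≤s _) tr≤n G ¬M lc =
  linkOfLast-¬matching G lc tr≤n ¬M , λ { refl → inducedFromTwo-¬matching G lc tr≤n ¬M }
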